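{- Let $k, \ell \geq 1$ be integers and, for $n \geq 1$, let $D_{k,\ell}(n)$ denote the number of Dyck paths from $(0,0)$ to $(2n-2,0)$ in which each up step is given one of $k$ types $U_1, \dots, U_k$ and each down step is given one of $\ell$ types $D_1, \dots, D_\ell$, such that no peak is of the type $U_1 D_1$ (i.e. no up step of type $U_1$ is immediately followed by a down step of type $D_1$). Then \[ D_{k,\ell}(n) = s_{k\ell-1}(n) \] for every $n \geq 1$.
   Context: A Dyck path from $(0,0)$ to $(2n-2,0)$ is a lattice path with steps $U=(1,1)$ and $D=(1,-1)$ never going below the $x$-axis; a peak is an occurrence of an up step immediately followed by a down step. A Schröder tree is a plane (ordered) rooted tree in which every internal node (non-leaf) has at least two children; the single-node tree has one leaf and no internal nodes. Let $s(n,k)$ be the number of Schröder trees with $n$ leaves and $k$ internal nodes, and for real $d$ let $s_d(n) = \sum_{j=0}^{n-1} s(n,j) d^j$ (convention $0^0 = 1$). -}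

module Defs where

open import Data.Nat using (ℕ; zero; suc; _+_; _*_; _∸_; _^_; _≡ᵇ_)
open import Data.Fin using (Fin; toℕ)
open import Data.Bool using (Bool; true; false; _∧_; not)
open import Data.List using (List; []; _∷_; length)
open import Data.Product using (Σ; _×_)
open import Data.Unit using (⊤)
open import Function.Bundles using (_↔_)
open import Relation.Binary.PropositionalEquality using (_≡_)
open import Data.Bool using (T)

HasCard : Set → ℕ → Set
HasCard A c = Fin c ↔ A

-- Coloured Dyck paths.
-- A step is an up step of type U_(i+1) (i : Fin k) or a down step of
-- type D_(j+1) (j : Fin ℓ).  Type U_1 / D_1 is the colour with toℕ ≡ 0.

data Step (k ℓ : ℕ) : Set where
  up   : Fin k → Step k ℓ
  down : Fin ℓ → Step k ℓ

dyckFrom : ∀ {k ℓ} → ℕ → List (Step k ℓ) → Bool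
dyckFrom zero    []            = true
dyckFrom (suc h) []            = false
dyckFrom h       (up _ ∷ w)    = dyckFrom (suc h) w
dyckFrom zero    (down _ ∷ w)  = false
dyckFrom (suc h) (down _ ∷ w)  = dyckFrom h w

isDyck : ∀ {k ℓ} → List (Step k ℓ) → Bool
isDyck = dyckFrom 0

noU1D1 : ∀ {k ℓ} → List (Step k ℓ) → Bool
noU1D1 []                       = true
noU1D1 (up i ∷ down j ∷ w)      =
  not ((toℕ i ≡ᵇ 0) ∧ (toℕ j ≡ᵇ 0)) ∧ noU1D1 (down j ∷ w)
noU1D1 (_ ∷ w)                  = noU1D1 w

ColouredDyck : ℕ → ℕ → ℕ → Set
ColouredDyck k ℓ n =
  Σ (List (Step k ℓ)) λ w →
    (length w ≡ 2 * n ∸ 2) × T (isDyck w) × T (noU1D1 w)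

data Tree : Set where
  node : List Tree → Tree

mutual
  leaves : Tree → ℕ
  leaves (node []) = 1
  leaves (node (t ∷ ts)) = leavesF (t ∷ ts)

  leavesF : List Tree → ℕ
  leavesF [] = 0
  leavesF (t ∷ ts) = leaves t + leavesF ts

mutual
  internal : Tree → ℕ
  internal (node []) = 0
  internal (node (t ∷ ts)) = suc (internalF (t ∷ ts))

  internalF : List Tree → ℕ
  internalF [] = 0
  internalF (t ∷ ts) = internal t + internalF ts

mutual
  isSchroeder : Tree → Bool
  isSchroeder (node [])           = true
  isSchroeder (node (t ∷ []))     = false
  isSchroeder (node (t ∷ u ∷ ts)) = isSchroederF (t ∷ u ∷ ts)

  isSchroederF : List Tree → Bool
  isSchroederF [] = true
  isSchroederF (t ∷ ts) = isSchroeder t ∧ isSchroederF ts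

SchroederTree : ℕ → ℕ → Set
SchroederTree n j =
  Σ Tree λ t → T (isSchroeder t) × (leaves t ≡ n) × (internal t ≡ j)

sumBelow : ℕ → (ℕ → ℕ) → ℕ
sumBelow zero    f = 0
sumBelow (suc n) f = sumBelow n f + f n

module Submission where

-- Both sides are in size-preserving bijection with one grammar of paths: a
-- path is a sequence of primes, and a prime is U_i p D_j with (i , j) one of
-- the kℓ − 1 colour pairs other than (1 , 1), or U₁ p D₁ with p nonempty.
-- On Dyck words this is the first-return decomposition, the nonemptiness
-- condition being exactly the absence of U₁D₁ peaks.  On Schröder trees whose
-- internal nodes carry one of the kℓ − 1 pairs, a node coloured c with
-- children t₁ , … , t_m becomes m − 1 nested primes, the innermost coloured
-- c, whose interiors encode t₂ , … , t_m, followed by the path of t₁.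
-- Counting coloured trees by their number of internal nodes gives
-- Σ s(n , j) (kℓ − 1)^j.

open import Defs
open import Data.Bool using (Bool; _∧_; not; T)
open import Data.Bool.Properties using (T-irrelevant; T-∧)
open import Data.Empty using (⊥-elim)
open import Data.Fin using (Fin; zero; suc; toℕ)
open import Data.Fin.Permutation using (↔⇒≡; cast-id)
open import Data.Fin.Properties using (+↔⊎; *↔×; 1↔⊤)
open import Data.List using (List; []; _∷_; length; _++_)
open import Data.List.Properties using (length-++)
import Data.Maybe as Maybe
open import Data.Maybe using (Maybe; just; nothing)
open import Data.Nat using (ℕ; zero; suc; _+_; _*_; _∸_; _^_; _≤_; _<_; z≤n; s≤s; _≡ᵇ_)
open import Data.Nat.Properties
open import Data.Nat.Tactic.RingSolver using (solve-∀)
open import Data.Product using (Σ; _×_; _,_; proj₁; proj₂; map₁; uncurry)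
open import Data.Product.Function.Dependent.Propositional using (Σ-↔)
open import Data.Product.Function.NonDependent.Propositional using (_×-↔_)
open import Data.Sum using (_⊎_; inj₁; inj₂)
open import Data.Sum.Function.Propositional using (_⊎-↔_)
open import Data.Unit using (⊤; tt)
open import Function using (_∘_)
open import Function.Bundles using (_↔_; mk↔ₛ′; Inverse; Equivalence)
open import Function.Properties.Inverse using (↔-refl; ↔-sym; ↔-trans)
open import Relation.Binary.PropositionalEquality
open import Relation.Nullary using (Irrelevant)

×-irrelevant : {A B : Set} → Irrelevant A → Irrelevant B → Irrelevant (A × B)
×-irrelevant irrA irrB (a , b) (a′ , b′) = cong₂ _,_ (irrA a a′) (irrB b b′)

Σ-≡-irrelevant : {A : Set} {P : A → Set} → (∀ {a} → Irrelevant (P a)) →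
                 {x y : Σ A P} → proj₁ x ≡ proj₁ y → x ≡ y
Σ-≡-irrelevant irr {a , p} {.a , q} refl = cong (a ,_) (irr p q)

⊎↔Σ<suc : ∀ n (B : ℕ → Set) →
          ((Σ ℕ λ j → j < n × B j) ⊎ B n) ↔ (Σ ℕ λ j → j < suc n × B j)
⊎↔Σ<suc n B = mk↔ₛ′ to from to∘from from∘to
  where
  to : (Σ ℕ λ j → j < n × B j) ⊎ B n → Σ ℕ λ j → j < suc n × B j
  to (inj₁ (j , j<n , b)) = j , m<n⇒m<1+n j<n , b
  to (inj₂ b)             = n , n<1+n n , b

  from : (Σ ℕ λ j → j < suc n × B j) → (Σ ℕ λ j → j < n × B j) ⊎ B n
  from (j , j<1+n , b) with m<1+n⇒m<n∨m≡n j<1+n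
  ... | inj₁ j<n  = inj₁ (j , j<n , b)
  ... | inj₂ refl = inj₂ b

  to∘from : ∀ x → to (from x) ≡ x
  to∘from (j , j<1+n , b) with m<1+n⇒m<n∨m≡n j<1+n
  ... | inj₁ _    = cong (λ lt → j , lt , b) (<-irrelevant _ _)
  ... | inj₂ refl = cong (λ lt → n , lt , b) (<-irrelevant _ _)

  from∘to : ∀ x → from (to x) ≡ x
  from∘to (inj₁ (j , j<n , b)) with m<1+n⇒m<n∨m≡n (m<n⇒m<1+n j<n)
  ... | inj₁ _    = cong (λ lt → inj₁ (j , lt , b)) (<-irrelevant _ _)
  ... | inj₂ refl = ⊥-elim (<-irrefl refl j<n)
  from∘to (inj₂ b) with m<1+n⇒m<n∨m≡n (n<1+n n)
  ... | inj₁ n<n  = ⊥-elim (<-irrefl refl n<n)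
  ... | inj₂ refl = refl

sumBelow↔ : ∀ n (f : ℕ → ℕ) → Fin (sumBelow n f) ↔ (Σ ℕ λ j → j < n × Fin (f j))
sumBelow↔ zero    f = mk↔ₛ′ (λ ()) (λ { (_ , () , _) }) (λ { (_ , () , _) }) (λ ())
sumBelow↔ (suc n) f =
  ↔-trans +↔⊎ (↔-trans (sumBelow↔ n f ⊎-↔ ↔-refl) (⊎↔Σ<suc n (Fin ∘ f)))

infixr 5 _·_

mutual
  data Path (C : Set) : Set where
    ε   : Path C
    _·_ : Prime C → Path C → Path C

  data Prime (C : Set) : Set where
    lift   : C → Path C → Prime C
    lift₁₁ : Prime C → Path C → Prime C

mutual
  size : {C : Set} → Path C → ℕ
  size ε       = 0
  size (x · p) = sizePrime x + size p

  sizePrime : {C : Set} → Prime C → ℕ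
  sizePrime (lift _ p)   = suc (size p)
  sizePrime (lift₁₁ x p) = suc (sizePrime x + size p)

notU₁D₁ : ∀ {k ℓ} → Fin k → Fin ℓ → Bool
notU₁D₁ i j = not ((toℕ i ≡ᵇ 0) ∧ (toℕ j ≡ᵇ 0))

PairColour : ℕ → ℕ → Set
PairColour k ℓ = Σ (Fin (suc k) × Fin (suc ℓ)) λ (i , j) → T (notU₁D₁ i j)

-- suc k * suc ℓ ∸ 1 reduces to ℓ + k * suc ℓ: the pairs (0 , j + 1) and (i + 1 , j).
pairColour↔ : ∀ k ℓ → Fin (suc k * suc ℓ ∸ 1) ↔ PairColour k ℓ
pairColour↔ k ℓ =
  ↔-trans +↔⊎ (↔-trans (↔-refl ⊎-↔ *↔×) (mk↔ₛ′ to from to∘from from∘to))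
  where
  to : Fin ℓ ⊎ (Fin k × Fin (suc ℓ)) → PairColour k ℓ
  to (inj₁ j)       = (zero , suc j) , tt
  to (inj₂ (i , j)) = (suc i , j) , tt

  from : PairColour k ℓ → Fin ℓ ⊎ (Fin k × Fin (suc ℓ))
  from ((zero  , zero)  , ())
  from ((zero  , suc j) , _) = inj₁ j
  from ((suc i , j)     , _) = inj₂ (i , j)

  to∘from : ∀ c → to (from c) ≡ c
  to∘from ((zero  , zero)  , ())
  to∘from ((zero  , suc j) , _) = refl
  to∘from ((suc i , j)     , _) = refl

  from∘to : ∀ x → from (to x) ≡ x
  from∘to (inj₁ j)       = refl
  from∘to (inj₂ (i , j)) = refl

mutual
  Colouring : Set → Tree → Set
  Colouring C (node [])       = ⊤
  Colouring C (node (t ∷ ts)) = C × Colourings C (t ∷ ts)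

  Colourings : Set → List Tree → Set
  Colourings C []       = ⊤
  Colourings C (t ∷ ts) = Colouring C t × Colourings C ts

module ColouredTrees (C : Set) where

  ColouredTree : Set
  ColouredTree = Σ Tree (Colouring C)

  mutual
    colouring↔ : ∀ {d} → Fin d ↔ C → ∀ t → Fin (d ^ internal t) ↔ Colouring C t
    colouring↔ c↔ (node [])       = 1↔⊤
    colouring↔ c↔ (node (t ∷ ts)) = ↔-trans *↔× (c↔ ×-↔ colourings↔ c↔ (t ∷ ts))

    colourings↔ : ∀ {d} → Fin d ↔ C → ∀ ts → Fin (d ^ internalF ts) ↔ Colourings C ts
    colourings↔     c↔ []       = 1↔⊤
    colourings↔ {d} c↔ (t ∷ ts) =
      ↔-trans (cast-id (^-distribˡ-+-* d (internal t) (internalF ts)))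
              (↔-trans *↔× (colouring↔ c↔ t ×-↔ colourings↔ c↔ ts))

  isSchroeder-∷⁻ : ∀ t ts → T (isSchroederF (t ∷ ts)) →
                   T (isSchroeder t) × T (isSchroederF ts)
  isSchroeder-∷⁻ t ts = Equivalence.to (T-∧ {isSchroeder t})

  isSchroeder-∷⁺ : ∀ t ts → T (isSchroeder t) → T (isSchroederF ts) →
                   T (isSchroederF (t ∷ ts))
  isSchroeder-∷⁺ t ts st sts = Equivalence.from (T-∧ {isSchroeder t}) (st , sts)

  mutual
    internal<leaves : ∀ t → T (isSchroeder t) → internal t < leaves t
    internal<leaves (node [])                  _ = s≤s z≤n
    internal<leaves (node ts@(_ ∷ _ ∷ _)) s = begin
      2 + internalF ts          ≡⟨ +-comm 2 (internalF ts) ⟩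
      internalF ts + 2          ≤⟨ +-monoʳ-≤ (internalF ts) (s≤s (s≤s z≤n)) ⟩
      internalF ts + length ts  ≤⟨ internalF+length≤leavesF ts s ⟩
      leavesF ts                ∎
      where open ≤-Reasoning

    internalF+length≤leavesF : ∀ ts → T (isSchroederF ts) →
                               internalF ts + length ts ≤ leavesF ts
    internalF+length≤leavesF []       _ = z≤n
    internalF+length≤leavesF (t ∷ ts) s = begin
      internal t + internalF ts + suc (length ts)
        ≡⟨ regroup (internal t) (internalF ts) (length ts) ⟩
      suc (internal t) + (internalF ts + length ts)
        ≤⟨ +-mono-≤ (internal<leaves t st) (internalF+length≤leavesF ts sts) ⟩
      leaves t + leavesF ts
        ∎
      where
      open ≤-Reasoning
      st : T (isSchroeder t)
      st = proj₁ (isSchroeder-∷⁻ t ts s)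
      sts : T (isSchroederF ts)
      sts = proj₂ (isSchroeder-∷⁻ t ts s)
      regroup : ∀ a b c → a + b + suc c ≡ suc a + (b + c)
      regroup = solve-∀

  mutual
    toPath : (t : Tree) → Colouring C t → Path C
    toPath (node [])           _                = ε
    toPath (node (_ ∷ []))     _                = ε
    toPath (node (t ∷ u ∷ us)) (c , γ , δ , δs) = toPrime c u δ us δs · toPath t γ

    toPrime : C → (u : Tree) → Colouring C u → (us : List Tree) → Colourings C us → Prime C
    toPrime c u δ []       _        = lift c (toPath u δ)
    toPrime c u δ (v ∷ vs) (η , ηs) = lift₁₁ (toPrime c v η vs ηs) (toPath u δ)

  -- A coloured node with at least two children, its first child removed.
  NodeTail : Set
  NodeTail = C × ColouredTree × Σ (List Tree) (Colourings C)

  attach : ColouredTree → NodeTail → ColouredTree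
  attach (t , γ) (c , (u , δ) , (us , δs)) = node (t ∷ u ∷ us) , c , γ , δ , δs

  push : ColouredTree → NodeTail → NodeTail
  push (u , δ) (c , (v , η) , (vs , ηs)) = c , (u , δ) , (v ∷ vs , η , ηs)

  toPrime′ : NodeTail → Prime C
  toPrime′ (c , (u , δ) , (us , δs)) = toPrime c u δ us δs

  tailLeaves : NodeTail → ℕ
  tailLeaves (_ , (u , _) , (us , _)) = leavesF (u ∷ us)

  SchroederTail : NodeTail → Set
  SchroederTail (_ , (u , _) , (us , _)) = T (isSchroederF (u ∷ us))

  mutual
    fromPath : Path C → ColouredTree
    fromPath ε       = node [] , tt
    fromPath (x · p) = attach (fromPath p) (fromPrime x)

    fromPrime : Prime C → NodeTail
    fromPrime (lift c p)   = c , fromPath p , ([] , tt)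
    fromPrime (lift₁₁ x p) = push (fromPath p) (fromPrime x)

  mutual
    toPath-fromPath : ∀ p → uncurry toPath (fromPath p) ≡ p
    toPath-fromPath ε       = refl
    toPath-fromPath (x · p) = cong₂ _·_ (toPrime-fromPrime x) (toPath-fromPath p)

    toPrime-fromPrime : ∀ x → toPrime′ (fromPrime x) ≡ x
    toPrime-fromPrime (lift c p)   = cong (lift c) (toPath-fromPath p)
    toPrime-fromPrime (lift₁₁ x p) = cong₂ lift₁₁ (toPrime-fromPrime x) (toPath-fromPath p)

  mutual
    fromPath-toPath : ∀ t (γ : Colouring C t) → T (isSchroeder t) →
                      fromPath (toPath t γ) ≡ (t , γ)
    fromPath-toPath (node [])           _                _  = refl
    fromPath-toPath (node (_ ∷ []))     _                ()
    fromPath-toPath (node (t ∷ u ∷ us)) (c , γ , δ , δs) s =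
      let st  , sus = isSchroeder-∷⁻ t (u ∷ us) s
          su  , sts = isSchroeder-∷⁻ u us sus
      in cong₂ attach (fromPath-toPath t γ st) (fromPrime-toPrime c u δ us δs su sts)

    fromPrime-toPrime : ∀ c u (δ : Colouring C u) us (δs : Colourings C us) →
                        T (isSchroeder u) → T (isSchroederF us) →
                        fromPrime (toPrime c u δ us δs) ≡ (c , (u , δ) , (us , δs))
    fromPrime-toPrime c u δ []       _        su _   =
      cong (λ uδ → c , uδ , ([] , tt)) (fromPath-toPath u δ su)
    fromPrime-toPrime c u δ (v ∷ vs) (η , ηs) su svs =
      let sv , svs′ = isSchroeder-∷⁻ v vs svs
      in cong₂ push (fromPath-toPath u δ su) (fromPrime-toPrime c v η vs ηs sv svs′)

  isSchroeder-attach : ∀ τ σ → T (isSchroeder (proj₁ τ)) → SchroederTail σ →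
                       T (isSchroeder (proj₁ (attach τ σ)))
  isSchroeder-attach (t , _) (_ , (u , _) , (us , _)) = isSchroeder-∷⁺ t (u ∷ us)

  schroederTail-push : ∀ τ σ → T (isSchroeder (proj₁ τ)) → SchroederTail σ →
                       SchroederTail (push τ σ)
  schroederTail-push (t , _) (_ , (u , _) , (us , _)) = isSchroeder-∷⁺ t (u ∷ us)

  mutual
    isSchroeder-fromPath : ∀ p → T (isSchroeder (proj₁ (fromPath p)))
    isSchroeder-fromPath ε       = tt
    isSchroeder-fromPath (x · p) =
      isSchroeder-attach (fromPath p) (fromPrime x) (isSchroeder-fromPath p) (schroederTail-fromPrime x)

    schroederTail-fromPrime : ∀ x → SchroederTail (fromPrime x)
    schroederTail-fromPrime (lift c p)   =
      isSchroeder-∷⁺ (proj₁ (fromPath p)) [] (isSchroeder-fromPath p) tt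
    schroederTail-fromPrime (lift₁₁ x p) =
      schroederTail-push (fromPath p) (fromPrime x) (isSchroeder-fromPath p) (schroederTail-fromPrime x)

  mutual
    leaves-fromPath : ∀ p → leaves (proj₁ (fromPath p)) ≡ suc (size p)
    leaves-fromPath ε       = refl
    leaves-fromPath (x · p) =
      trans (cong₂ _+_ (leaves-fromPath p) (tailLeaves-fromPrime x))
            (cong suc (+-comm (size p) (sizePrime x)))

    tailLeaves-fromPrime : ∀ x → tailLeaves (fromPrime x) ≡ sizePrime x
    tailLeaves-fromPrime (lift c p)   = trans (+-identityʳ _) (leaves-fromPath p)
    tailLeaves-fromPrime (lift₁₁ x p) =
      trans (cong₂ _+_ (leaves-fromPath p) (tailLeaves-fromPrime x))
            (cong suc (+-comm (size p) (sizePrime x)))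

  ColouredSchroeder : ℕ → Set
  ColouredSchroeder n = Σ ColouredTree λ (t , _) → T (isSchroeder t) × leaves t ≡ n

  colouredSchroeder↔path : ∀ m → ColouredSchroeder (suc m) ↔ Σ (Path C) λ p → size p ≡ m
  colouredSchroeder↔path m = mk↔ₛ′ to from to∘from from∘to
    where
    to : ColouredSchroeder (suc m) → Σ (Path C) λ p → size p ≡ m
    to ((t , γ) , s , l) = toPath t γ , suc-injective (begin
      suc (size (toPath t γ))                ≡⟨ leaves-fromPath (toPath t γ) ⟨
      leaves (proj₁ (fromPath (toPath t γ))) ≡⟨ cong (leaves ∘ proj₁) (fromPath-toPath t γ s) ⟩
      leaves t                               ≡⟨ l ⟩
      suc m                                  ∎)
      where open ≡-Reasoning

    from : (Σ (Path C) λ p → size p ≡ m) → ColouredSchroeder (suc m)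
    from (p , eq) = fromPath p , isSchroeder-fromPath p , trans (leaves-fromPath p) (cong suc eq)

    to∘from : ∀ x → to (from x) ≡ x
    to∘from (p , _) = Σ-≡-irrelevant ≡-irrelevant (toPath-fromPath p)

    from∘to : ∀ x → from (to x) ≡ x
    from∘to ((t , γ) , s , _) =
      Σ-≡-irrelevant (×-irrelevant T-irrelevant ≡-irrelevant) (fromPath-toPath t γ s)

  ColouredSchroederByInternal : ℕ → Set
  ColouredSchroederByInternal n = Σ ℕ λ j → j < n × Σ (SchroederTree n j) (Colouring C ∘ proj₁)

  forgetInternal↔ : ∀ n → ColouredSchroederByInternal n ↔ ColouredSchroeder n
  forgetInternal↔ n = mk↔ₛ′ to from (λ _ → refl) from∘to
    where
    to : ColouredSchroederByInternal n → ColouredSchroeder n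
    to (_ , _ , ((t , s , l , _) , γ)) = (t , γ) , s , l

    from : ColouredSchroeder n → ColouredSchroederByInternal n
    from ((t , γ) , s , l) =
      internal t , subst (internal t <_) l (internal<leaves t s) , ((t , s , l , refl) , γ)

    from∘to : ∀ x → from (to x) ≡ x
    from∘to (_ , _ , ((t , s , l , refl) , γ)) =
      cong (λ lt → internal t , lt , ((t , s , l , refl) , γ)) (<-irrelevant _ _)

  weightedSum↔ : ∀ {d} → Fin d ↔ C → ∀ n (s : ℕ → ℕ) →
                 (∀ j → HasCard (SchroederTree n j) (s j)) →
                 Fin (sumBelow n λ j → s j * d ^ j) ↔ ColouredSchroeder n
  weightedSum↔ {d} c↔ n s s-card =
    ↔-trans (sumBelow↔ n _)
            (↔-trans (Σ-↔ ↔-refl (↔-refl ×-↔ term↔)) (forgetInternal↔ n))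
    where
    colouringOf : ∀ {j} (t : SchroederTree n j) → Fin (d ^ j) ↔ Colouring C (proj₁ t)
    colouringOf (t , _ , _ , refl) = colouring↔ c↔ t

    term↔ : ∀ {j} → Fin (s j * d ^ j) ↔ Σ (SchroederTree n j) (Colouring C ∘ proj₁)
    term↔ {j} =
      ↔-trans *↔× (Σ-↔ (s-card j) (λ {x} → colouringOf (Inverse.to (s-card j) x)))

module DyckPaths (k ℓ : ℕ) where

  Word : Set
  Word = List (Step (suc k) (suc ℓ))

  ColouredPath : Set
  ColouredPath = Path (PairColour k ℓ)

  mutual
    encode : ColouredPath → Word → Word
    encode ε       w = w
    encode (x · p) w = encodePrime x (encode p w)

    encodePrime : Prime (PairColour k ℓ) → Word → Word
    encodePrime (lift ((i , j) , _) p) w = up i ∷ encode p (down j ∷ w)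
    encodePrime (lift₁₁ x p)          w = up zero ∷ encodePrime x (encode p (down zero ∷ w))

  mutual
    encode-++ : ∀ p (u w : Word) → encode p (u ++ w) ≡ encode p u ++ w
    encode-++ ε       u w = refl
    encode-++ (x · p) u w =
      trans (cong (encodePrime x) (encode-++ p u w)) (encodePrime-++ x (encode p u) w)

    encodePrime-++ : ∀ x (u w : Word) → encodePrime x (u ++ w) ≡ encodePrime x u ++ w
    encodePrime-++ (lift ((i , j) , _) p) u w = cong (up i ∷_) (encode-++ p (down j ∷ u) w)
    encodePrime-++ (lift₁₁ x p)          u w = cong (up zero ∷_)
      (trans (cong (encodePrime x) (encode-++ p (down zero ∷ u) w))
             (encodePrime-++ x (encode p (down zero ∷ u)) w))

  mutual
    length-encode : ∀ p (w : Word) → length (encode p w) ≡ 2 * size p + length w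
    length-encode ε       w = refl
    length-encode (x · p) w = begin
      length (encodePrime x (encode p w))         ≡⟨ length-encodePrime x (encode p w) ⟩
      2 * sizePrime x + length (encode p w)       ≡⟨ cong (2 * sizePrime x +_) (length-encode p w) ⟩
      2 * sizePrime x + (2 * size p + length w)   ≡⟨ regroup (sizePrime x) (size p) (length w) ⟩
      2 * (sizePrime x + size p) + length w       ∎
      where
      open ≡-Reasoning
      regroup : ∀ a b c → 2 * a + (2 * b + c) ≡ 2 * (a + b) + c
      regroup = solve-∀

    length-encodePrime : ∀ x (w : Word) → length (encodePrime x w) ≡ 2 * sizePrime x + length w
    length-encodePrime (lift ((i , j) , _) p) w =
      trans (cong suc (length-encode p (down j ∷ w))) (regroup (size p) (length w))
      where
      regroup : ∀ b c → suc (2 * b + suc c) ≡ 2 * suc b + c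
      regroup = solve-∀
    length-encodePrime (lift₁₁ x p) w = begin
      suc (length (encodePrime x (encode p (down zero ∷ w))))
        ≡⟨ cong suc (length-encodePrime x _) ⟩
      suc (2 * sizePrime x + length (encode p (down zero ∷ w)))
        ≡⟨ cong (λ n → suc (2 * sizePrime x + n)) (length-encode p (down zero ∷ w)) ⟩
      suc (2 * sizePrime x + (2 * size p + suc (length w)))
        ≡⟨ regroup (sizePrime x) (size p) (length w) ⟩
      2 * suc (sizePrime x + size p) + length w ∎
      where
      open ≡-Reasoning
      regroup : ∀ a b c → suc (2 * a + (2 * b + suc c)) ≡ 2 * suc (a + b) + c
      regroup = solve-∀

  length-word : ∀ p → length (encode p []) ≡ 2 * size p
  length-word p = trans (length-encode p []) (+-identityʳ _)

  dyckFrom-up : ∀ h i (w : Word) → dyckFrom h (up i ∷ w) ≡ dyckFrom (suc h) w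
  dyckFrom-up zero    i w = refl
  dyckFrom-up (suc h) i w = refl

  mutual
    dyckFrom-encode : ∀ h p (w : Word) → dyckFrom h (encode p w) ≡ dyckFrom h w
    dyckFrom-encode h ε       w = refl
    dyckFrom-encode h (x · p) w = trans (dyckFrom-encodePrime h x _) (dyckFrom-encode h p w)

    dyckFrom-encodePrime : ∀ h x (w : Word) → dyckFrom h (encodePrime x w) ≡ dyckFrom h w
    dyckFrom-encodePrime h (lift ((i , j) , _) p) w =
      trans (dyckFrom-up h i _) (dyckFrom-encode (suc h) p (down j ∷ w))
    dyckFrom-encodePrime h (lift₁₁ x p) w =
      trans (dyckFrom-up h zero _)
            (trans (dyckFrom-encodePrime (suc h) x _) (dyckFrom-encode (suc h) p (down zero ∷ w)))

  noU1D1-up∷encodePrime : ∀ i x (w : Word) →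
                          noU1D1 (up i ∷ encodePrime x w) ≡ noU1D1 (encodePrime x w)
  noU1D1-up∷encodePrime i (lift _ _)   w = refl
  noU1D1-up∷encodePrime i (lift₁₁ _ _) w = refl

  mutual
    noU1D1-encode : ∀ p (w : Word) → T (noU1D1 w) → T (noU1D1 (encode p w))
    noU1D1-encode ε       w nu = nu
    noU1D1-encode (x · p) w nu = noU1D1-encodePrime x _ (noU1D1-encode p w nu)

    noU1D1-encodePrime : ∀ x (w : Word) → T (noU1D1 w) → T (noU1D1 (encodePrime x w))
    noU1D1-encodePrime (lift ((i , j) , ok) ε) w nu =
      Equivalence.from (T-∧ {notU₁D₁ i j}) (ok , nu)
    noU1D1-encodePrime (lift ((i , j) , _) (x · p)) w nu =
      subst T (sym (noU1D1-up∷encodePrime i x _)) (noU1D1-encode (x · p) (down j ∷ w) nu)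
    noU1D1-encodePrime (lift₁₁ x p) w nu =
      subst T (sym (noU1D1-up∷encodePrime zero x _))
              (noU1D1-encodePrime x _ (noU1D1-encode p (down zero ∷ w) nu))

  noU1D1-∷⁻ : ∀ s (w : Word) → T (noU1D1 (s ∷ w)) → T (noU1D1 w)
  noU1D1-∷⁻ (down _) w            nu = nu
  noU1D1-∷⁻ (up _)   []           nu = tt
  noU1D1-∷⁻ (up _)   (up _ ∷ w)   nu = nu
  noU1D1-∷⁻ (up i)   (down j ∷ w) nu = proj₂ (Equivalence.to (T-∧ {notU₁D₁ i j}) nu)

  noU1D1-++⁻ʳ : ∀ (u w : Word) → T (noU1D1 (u ++ w)) → T (noU1D1 w)
  noU1D1-++⁻ʳ []      w nu = nu
  noU1D1-++⁻ʳ (s ∷ u) w nu = noU1D1-++⁻ʳ u w (noU1D1-∷⁻ s (u ++ w) nu)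

  noU1D1-++⁻ˡ : ∀ (u w : Word) → T (noU1D1 (u ++ w)) → T (noU1D1 u)
  noU1D1-++⁻ˡ []                  w nu = tt
  noU1D1-++⁻ˡ (down _ ∷ u)        w nu = noU1D1-++⁻ˡ u w nu
  noU1D1-++⁻ˡ (up _ ∷ [])         w nu = tt
  noU1D1-++⁻ˡ (up _ ∷ up i ∷ u)   w nu = noU1D1-++⁻ˡ (up i ∷ u) w nu
  noU1D1-++⁻ˡ (up i ∷ down j ∷ u) w nu =
    let ok , nu′ = Equivalence.to (T-∧ {notU₁D₁ i j}) nu
    in Equivalence.from (T-∧ {notU₁D₁ i j}) (ok , noU1D1-++⁻ˡ (down j ∷ u) w nu′)

  Split : Set
  Split = Word × Fin (suc ℓ) × Word

  split : ℕ → Word → Maybe Split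
  split h       []           = nothing
  split h       (up i ∷ w)   = Maybe.map (map₁ (up i ∷_)) (split (suc h) w)
  split zero    (down j ∷ w) = just ([] , j , w)
  split (suc h) (down j ∷ w) = Maybe.map (map₁ (down j ∷_)) (split h w)

  mutual
    split-encode : ∀ h p {w P j Q} → split h w ≡ just (P , j , Q) →
                   split h (encode p w) ≡ just (encode p P , j , Q)
    split-encode h ε       eq = eq
    split-encode h (x · p) eq = split-encodePrime h x (split-encode h p eq)

    split-encodePrime : ∀ h x {w P j Q} → split h w ≡ just (P , j , Q) →
                        split h (encodePrime x w) ≡ just (encodePrime x P , j , Q)
    split-encodePrime h (lift ((i , j′) , _) p) eq =
      cong (Maybe.map (map₁ (up i ∷_)))
           (split-encode (suc h) p (cong (Maybe.map (map₁ (down j′ ∷_))) eq))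
    split-encodePrime h (lift₁₁ x p) eq =
      cong (Maybe.map (map₁ (up zero ∷_)))
           (split-encodePrime (suc h) x
             (split-encode (suc h) p (cong (Maybe.map (map₁ (down zero ∷_))) eq)))

  split-dyckFrom : ∀ h g (w : Word) → T (dyckFrom (h + suc g) w) →
    Σ Word λ P → Σ (Fin (suc ℓ)) λ j → Σ Word λ Q →
      split h w ≡ just (P , j , Q) × w ≡ P ++ down j ∷ Q × T (dyckFrom h P) × T (dyckFrom g Q)
  split-dyckFrom zero    g []           ()
  split-dyckFrom (suc h) g []           ()
  split-dyckFrom h       g (up i ∷ w)   dy
    with P , j , Q , eq , refl , dyP , dyQ
           ← split-dyckFrom (suc h) g w (subst T (dyckFrom-up (h + suc g) i w) dy)
    = up i ∷ P , j , Q , cong (Maybe.map (map₁ (up i ∷_))) eq , refl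
    , subst T (sym (dyckFrom-up h i P)) dyP , dyQ
  split-dyckFrom zero    g (down j ∷ w) dy = [] , j , w , refl , refl , tt , dy
  split-dyckFrom (suc h) g (down j ∷ w) dy
    with P , j′ , Q , eq , refl , dyP , dyQ ← split-dyckFrom h g w dy
    = down j ∷ P , j′ , Q , cong (Maybe.map (map₁ (down j ∷_))) eq , refl , dyP , dyQ

  -- The path U_i p D_j q; junk when this would create the forbidden peak U₁D₁.
  consLift : Fin (suc k) → Fin (suc ℓ) → ColouredPath → ColouredPath → ColouredPath
  consLift zero    zero    ε       q = ε
  consLift zero    zero    (x · p) q = lift₁₁ x p · q
  consLift zero    (suc j) p       q = lift ((zero , suc j) , tt) p · q
  consLift (suc i) j       p       q = lift ((suc i , j) , tt) p · q

  consLift-lift : ∀ {i j} p q (ok : T (notU₁D₁ i j)) →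
                  consLift i j p q ≡ lift ((i , j) , ok) p · q
  consLift-lift {zero}  {zero}  p q ()
  consLift-lift {zero}  {suc j} p q _ = refl
  consLift-lift {suc i} {j}     p q _ = refl

  encode-consLift : ∀ i j p q {w : Word} → T (noU1D1 (up i ∷ encode p [] ++ down j ∷ w)) →
                    encode (consLift i j p q) [] ≡ up i ∷ encode p (down j ∷ encode q [])
  encode-consLift zero    zero    ε       q ()
  encode-consLift zero    zero    (x · p) q _ = refl
  encode-consLift zero    (suc j) p       q _ = refl
  encode-consLift (suc i) j       p       q _ = refl

  -- The first argument is fuel; the length of the word always suffices.
  decode : ℕ → Word → ColouredPath
  decode (suc n) (up i ∷ w) with split 0 w
  ... | just (P , j , Q) = consLift i j (decode n P) (decode n Q)
  ... | nothing          = ε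
  decode _ _ = ε

  decode-up : ∀ n i j p (w : Word) →
    decode (suc n) (up i ∷ encode p (down j ∷ w))
      ≡ consLift i j (decode n (encode p [])) (decode n w)
  decode-up n i j p w rewrite split-encode 0 p {w = down j ∷ w} refl = refl

  decode-encode : ∀ n p → size p ≤ n → decode n (encode p []) ≡ p
  decode-encode zero    ε                    _ = refl
  decode-encode (suc n) ε                    _ = refl
  decode-encode zero    (lift _ _ · _)       ()
  decode-encode zero    (lift₁₁ _ _ · _)     ()
  decode-encode (suc n) (lift ((i , j) , ok) p · q) (s≤s le) = begin
    decode (suc n) (up i ∷ encode p (down j ∷ encode q []))        ≡⟨ decode-up n i j p _ ⟩
    consLift i j (decode n (encode p [])) (decode n (encode q []))
      ≡⟨ cong₂ (consLift i j) (decode-encode n p (m+n≤o⇒m≤o _ le))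
                              (decode-encode n q (m+n≤o⇒n≤o _ le)) ⟩
    consLift i j p q                                                ≡⟨ consLift-lift p q ok ⟩
    lift ((i , j) , ok) p · q                                       ∎
    where open ≡-Reasoning
  decode-encode (suc n) (lift₁₁ x p · q) (s≤s le) =
    trans (decode-up n zero zero (x · p) _)
          (cong₂ (consLift zero zero) (decode-encode n (x · p) (m+n≤o⇒m≤o _ le))
                                      (decode-encode n q (m+n≤o⇒n≤o _ le)))

  encode-decode : ∀ n (w : Word) → length w ≤ n → T (isDyck w) → T (noU1D1 w) →
                  encode (decode n w) [] ≡ w
  encode-decode zero    []           _ _  _ = refl
  encode-decode (suc n) []           _ _  _ = refl
  encode-decode (suc n) (down _ ∷ _) _ () _
  encode-decode (suc n) (up i ∷ w) (s≤s le) dy nu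
    with P , j , Q , eq , refl , dyP , dyQ ← split-dyckFrom 0 0 w dy
    rewrite eq = begin
      encode (consLift i j p q) []                  ≡⟨ encode-consLift i j p q nu′ ⟩
      up i ∷ encode p (down j ∷ encode q [])        ≡⟨ cong (up i ∷_) (encode-++ p [] _) ⟩
      up i ∷ encode p [] ++ down j ∷ encode q []
        ≡⟨ cong₂ (λ P′ Q′ → up i ∷ P′ ++ down j ∷ Q′) P≡ Q≡ ⟩
      up i ∷ P ++ down j ∷ Q                        ∎
    where
    open ≡-Reasoning
    p q : ColouredPath
    p = decode n P
    q = decode n Q

    lenPQ : length P + suc (length Q) ≤ n
    lenPQ = subst (_≤ n) (length-++ P) le

    nuPQ : T (noU1D1 (P ++ down j ∷ Q))
    nuPQ = noU1D1-∷⁻ (up i) (P ++ down j ∷ Q) nu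

    P≡ : encode p [] ≡ P
    P≡ = encode-decode n P (m+n≤o⇒m≤o (length P) lenPQ) dyP (noU1D1-++⁻ˡ P (down j ∷ Q) nuPQ)

    Q≡ : encode q [] ≡ Q
    Q≡ = encode-decode n Q (<⇒≤ (m+n≤o⇒n≤o (length P) lenPQ)) dyQ (noU1D1-++⁻ʳ P (down j ∷ Q) nuPQ)

    nu′ : T (noU1D1 (up i ∷ encode p [] ++ down j ∷ Q))
    nu′ = subst (λ P′ → T (noU1D1 (up i ∷ P′ ++ down j ∷ Q))) (sym P≡) nu

  dyck↔path : ∀ m → ColouredDyck (suc k) (suc ℓ) (suc m) ↔ Σ ColouredPath λ p → size p ≡ m
  dyck↔path m = mk↔ₛ′ to from to∘from from∘to
    where
    open ≡-Reasoning

    length≡ : 2 * suc m ∸ 2 ≡ 2 * m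
    length≡ = sym (*-distribˡ-∸ 2 (suc m) 1)

    size≡ : ∀ p → length (encode p []) ≡ 2 * suc m ∸ 2 → size p ≡ m
    size≡ p eq = *-cancelˡ-≡ (size p) m 2 (begin
      2 * size p              ≡⟨ length-word p ⟨
      length (encode p [])    ≡⟨ eq ⟩
      2 * suc m ∸ 2           ≡⟨ length≡ ⟩
      2 * m                   ∎)

    to : ColouredDyck (suc k) (suc ℓ) (suc m) → Σ ColouredPath λ p → size p ≡ m
    to (w , len , dy , nu) =
      decode (length w) w ,
      size≡ (decode (length w) w)
            (trans (cong length (encode-decode (length w) w ≤-refl dy nu)) len)

    from : (Σ ColouredPath λ p → size p ≡ m) → ColouredDyck (suc k) (suc ℓ) (suc m)
    from (p , eq) =
      encode p [] ,
      trans (length-word p) (trans (cong (2 *_) eq) (sym length≡)) ,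
      subst T (sym (dyckFrom-encode 0 p [])) tt ,
      noU1D1-encode p [] tt

    size≤length : ∀ p → size p ≤ length (encode p [])
    size≤length p = subst (size p ≤_) (sym (length-word p)) (m≤m+n (size p) _)

    to∘from : ∀ x → to (from x) ≡ x
    to∘from (p , _) = Σ-≡-irrelevant ≡-irrelevant (decode-encode _ p (size≤length p))

    from∘to : ∀ x → from (to x) ≡ x
    from∘to (w , _ , dy , nu) =
      Σ-≡-irrelevant (×-irrelevant ≡-irrelevant (×-irrelevant T-irrelevant T-irrelevant))
                     (encode-decode (length w) w ≤-refl dy nu)

open ColouredTrees using (colouredSchroeder↔path; weightedSum↔)
open DyckPaths using (dyck↔path)

proposition15 : (k ℓ n : ℕ) → 1 ≤ k → 1 ≤ ℓ → 1 ≤ n →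
    (s : ℕ → ℕ) → (∀ j → HasCard (SchroederTree n j) (s j)) →
    (D : ℕ) → HasCard (ColouredDyck k ℓ n) D →
    D ≡ sumBelow n (λ j → s j * (k * ℓ ∸ 1) ^ j)
proposition15 (suc k) (suc ℓ) (suc m) (s≤s z≤n) (s≤s z≤n) (s≤s z≤n) s s-card D D-card =
  ↔⇒≡ (↔-trans D-card (↔-trans (dyck↔path k ℓ m) (↔-sym (↔-trans weights↔trees trees↔paths))))
  where
  weights↔trees : Fin (sumBelow (suc m) λ j → s j * (suc k * suc ℓ ∸ 1) ^ j)
                ↔ ColouredTrees.ColouredSchroeder (PairColour k ℓ) (suc m)
  weights↔trees = weightedSum↔ (PairColour k ℓ) (pairColour↔ k ℓ) (suc m) s s-card

  trees↔paths : ColouredTrees.ColouredSchroeder (PairColour k ℓ) (suc m)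
              ↔ Σ (Path (PairColour k ℓ)) λ p → size p ≡ m
  trees↔paths = colouredSchroeder↔path (PairColour k ℓ) m
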